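{- Let $m \geqslant 5$ be an odd integer. The digraph $H_{2m} = \vec{X}(m, \{\pm 1\}) \wr \overline{K}_2$ admits a $\vec{C}_m$-factorization.
   Context: For $D \subseteq \{1,\ldots,m-1\}$, the directed circulant $\vec{X}(m,D)$ has vertex set $\mathbb{Z}_m$ and arcs $(a,b)$ with $b-a \in D$ (mod $m$); $\{\pm1\}$ means $\{1, m-1\}$. The wreath product $G \wr H$ of digraphs has vertex set $V(G)\times V(H)$ and an arc from $(g_1,h_1)$ to $(g_2,h_2)$ iff $(g_1,g_2)\in A(G)$, or $g_1=g_2$ and $(h_1,h_2)\in A(H)$. $\overline{K}_2$ is the digraph on two vertices with no arcs. A $\vec{C}_m$-factor of a digraph is a spanning subdigraph that is a disjoint union of directed $m$-cycles; a $\vec{C}_m$-factorization is a partition of the arc set into the arc sets of $\vec{C}_m$-factors. -}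

module Defs where

open import Data.Nat using (ℕ; zero; suc; _+_; _∸_; _<_; _%_; NonZero)
open import Data.Fin using (Fin; toℕ)
open import Data.Product using (Σ; _×_; _,_)
open import Data.Sum using (_⊎_)
open import Data.Empty using (⊥)
open import Relation.Binary.PropositionalEquality using (_≡_)
open import Relation.Nullary using (¬_)

Digraph : Set → Set₁
Digraph V = V → V → Set

finNonZero : {m : ℕ} → Fin m → NonZero m
finNonZero {suc m} _ = _

diffMod : (m : ℕ) → Fin m → Fin m → ℕ
diffMod m a b = _%_ (toℕ b + (m ∸ toℕ a)) m {{finNonZero a}}

-- Directed circulant X(m, D), D given as a predicate on {1,…,m-1}.
Circulant : (m : ℕ) → (ℕ → Set) → Digraph (Fin m)
Circulant m D a b = D (diffMod m a b)

PlusMinusOne : ℕ → ℕ → Set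
PlusMinusOne m d = (d ≡ 1) ⊎ (d ≡ m ∸ 1)

Wreath : {V W : Set} → Digraph V → Digraph W → Digraph (V × W)
Wreath G H (g₁ , h₁) (g₂ , h₂) = G g₁ g₂ ⊎ ((g₁ ≡ g₂) × H h₁ h₂)

EmptyK2 : Digraph (Fin 2)
EmptyK2 _ _ = ⊥

H2m : (m : ℕ) → Digraph (Fin m × Fin 2)
H2m m = Wreath (Circulant m (PlusMinusOne m)) EmptyK2

iterate : {V : Set} → (V → V) → ℕ → V → V
iterate f zero v = v
iterate f (suc n) v = f (iterate f n v)

-- A C_m-factor of G: a spanning subdigraph in which each vertex v has exactly
-- one out-arc (v , σ v) (and, as a consequence of the cycle condition, exactly
-- one in-arc), all of whose components are directed m-cycles: every vertex
-- returns to itself after exactly m steps and not earlier.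
record CmFactor {V : Set} (m : ℕ) (G : Digraph V) : Set where
  field
    succ     : V → V
    isArc    : ∀ v → G v (succ v)
    closes   : ∀ v → iterate succ m v ≡ v
    minimal  : ∀ v (i : ℕ) → 0 < i → i < m → ¬ (iterate succ i v ≡ v)

record CmFactorization {V : Set} (m : ℕ) (G : Digraph V) : Set where
  field
    k         : ℕ
    factor    : Fin k → CmFactor m G
    partition : ∀ u v → G u v →
      Σ (Fin k) λ i → (CmFactor.succ (factor i) u ≡ v)
        × (∀ j → CmFactor.succ (factor j) u ≡ v → j ≡ i)

-- For s : ℤₘ → 𝔽₂, the vertices (x , s x) and (x , 1 - s x) of H₂ₘ form two
-- "tracks"; stepping by +1 along the first and by -1 along the second gives a
-- C_m-factor F_s. The arc (x , a) → (x + 1 , b) lies in F_s iff s x = a and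
-- s (x + 1) = b, and the arc (x , a) → (x - 1 , b) iff s (x - 1) = 1 - b and
-- s x = 1 - a. Hence selectors s₀ … s₃ give a factorization as soon as, at
-- every x, j ↦ (s_j x , s_j (x + 1)) is a bijection onto 𝔽₂². This holds for
-- s_j x = w_j (c x), where c is a proper 3-colouring of the cycle ℤₘ and
-- w₀ … w₃ are the even-weight words of 𝔽₂³.

module Submission where

open import Defs
open import Data.Nat using (ℕ; zero; suc; _+_; _*_; _∸_; _≤_; _<_; _%_; _/_; z≤n; s≤s; NonZero)
open import Data.Nat.Properties hiding (_≟_)
open import Data.Nat.DivMod
open import Data.Nat.Divisibility using (divides; >⇒∤)
open import Data.Bool using (if_then_else_)
open import Data.Fin as Fin using (Fin; toℕ; fromℕ<; _≟_)
open import Data.Fin.Patterns using (0F; 1F; 2F)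
open import Data.Fin.Properties using (toℕ<n; toℕ-fromℕ<; toℕ-injective; any?; all?)
open import Data.Product using (Σ; _×_; _,_; proj₁; proj₂)
open import Data.Sum using (inj₁; inj₂)
open import Data.Empty using (⊥-elim)
open import Function.Bundles using (_⇔_; mk⇔; Equivalence)
open import Relation.Unary using (Decidable)
open import Relation.Nullary using (Dec; yes; no; does; ¬?; _×-dec_; _→-dec_)
open import Relation.Nullary.Decidable using (from-yes)
open import Relation.Binary.PropositionalEquality
  using (_≡_; _≢_; refl; sym; trans; cong; subst; subst₂; module ≡-Reasoning)

ExactlyOne : {A : Set} → (A → Set) → Set
ExactlyOne {A} P = Σ A λ i → P i × (∀ j → P j → j ≡ i)

ExactlyOne-⇔ : {A : Set} {P Q : A → Set} → (∀ i → P i ⇔ Q i) → ExactlyOne P → ExactlyOne Q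
ExactlyOne-⇔ P⇔Q (i , Pi , unique) =
  i , Equivalence.to (P⇔Q i) Pi , λ j Qj → unique j (Equivalence.from (P⇔Q j) Qj)

exactlyOne? : ∀ {k} {P : Fin k → Set} → Decidable P → Dec (ExactlyOne P)
exactlyOne? P? = any? λ i → P? i ×-dec all? λ j → P? j →-dec j ≟ i

OnCycle : {A : Set} → ℕ → (A → A) → A → Set
OnCycle k f x = iterate f k x ≡ x × (∀ i → 0 < i → i < k → iterate f i x ≢ x)

iterate-along : {A B : Set} (f : A → A) (t : A → B) (T : A × B → A × B) →
  (∀ x → T (x , t x) ≡ (f x , t (f x))) →
  ∀ i x → iterate T i (x , t x) ≡ (iterate f i x , t (iterate f i x))
iterate-along f t T T-along zero x = refl
iterate-along f t T T-along (suc i) x = trans (cong T (iterate-along f t T T-along i x))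
                                              (T-along (iterate f i x))

OnCycle-along : {A B : Set} {f : A → A} {t : A → B} {T : A × B → A × B} →
  (∀ x → T (x , t x) ≡ (f x , t (f x))) →
  ∀ {k x} → OnCycle k f x → OnCycle k T (x , t x)
OnCycle-along {f = f} {t} {T} T-along {k} {x} (closes , minimal) =
  trans (along k) (cong (λ y → y , t y) closes) ,
  λ i 0<i i<k eq → minimal i 0<i i<k (cong proj₁ (trans (sym (along i)) eq))
  where
  along : ∀ i → iterate T i (x , t x) ≡ (iterate f i x , t (iterate f i x))
  along i = iterate-along f t T T-along i x

[a%m+b]%m≡[a+b]%m : ∀ a b m .{{_ : NonZero m}} → (a % m + b) % m ≡ (a + b) % m
[a%m+b]%m≡[a+b]%m a b m = begin
  (a % m + b) % m          ≡⟨ %-distribˡ-+ (a % m) b m ⟩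
  (a % m % m + b % m) % m  ≡⟨ cong (λ r → (r + b % m) % m) (m%n%n≡m%n a m) ⟩
  (a % m + b % m) % m      ≡⟨ sym (%-distribˡ-+ a b m) ⟩
  (a + b) % m              ∎
  where open ≡-Reasoning

flip : Fin 2 → Fin 2
flip 0F = 1F
flip 1F = 0F

flip-involutive : ∀ a → flip (flip a) ≡ a
flip-involutive 0F = refl
flip-involutive 1F = refl

flip-≢ : ∀ a → flip a ≢ a
flip-≢ 0F ()
flip-≢ 1F ()

≢⇒≡flip : ∀ {a b : Fin 2} → a ≢ b → b ≡ flip a
≢⇒≡flip {0F} {0F} a≢b = ⊥-elim (a≢b refl)
≢⇒≡flip {0F} {1F} _ = refl
≢⇒≡flip {1F} {0F} _ = refl
≢⇒≡flip {1F} {1F} a≢b = ⊥-elim (a≢b refl)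

colour : ℕ → Fin 3
colour zero = 0F
colour (suc zero) = 1F
colour (suc (suc zero)) = 2F
colour (suc (suc (suc i))) = colour (suc i)

colour-suc-≢ : ∀ i → colour i ≢ colour (suc i)
colour-suc-≢ zero ()
colour-suc-≢ (suc zero) ()
colour-suc-≢ (suc (suc zero)) ()
colour-suc-≢ (suc (suc (suc i))) = colour-suc-≢ (suc i)

colour-≢0 : ∀ {i} → 0 < i → colour i ≢ 0F
colour-≢0 {suc zero} _ ()
colour-≢0 {suc (suc zero)} _ ()
colour-≢0 {suc (suc (suc i))} _ = colour-≢0 {suc i} (s≤s z≤n)

-- The rows are the even-weight words 000, 011, 101, 110 of 𝔽₂³.
codeword : Fin 4 → Fin 3 → Fin 2
codeword 0F _ = 0F
codeword (Fin.suc i) p = if does (i ≟ p) then 0F else 1F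

-- Two distinct coordinates are independent linear functionals on this
-- 2-dimensional code; checked exhaustively.
codeword-orthogonal : ∀ p q → p ≢ q → ∀ a b →
  ExactlyOne λ j → codeword j p ≡ a × codeword j q ≡ b
codeword-orthogonal = from-yes
  (all? λ p → all? λ q → ¬? (p ≟ q) →-dec all? λ a → all? λ b →
    exactlyOne? λ j → codeword j p ≟ a ×-dec codeword j q ≟ b)

module CyclicShift (n : ℕ) where

  m : ℕ
  m = suc n

  shift : ℕ → Fin m → Fin m
  shift d x = fromℕ< (m%n<n (d + toℕ x) m)

  toℕ-shift : ∀ d x → toℕ (shift d x) ≡ (d + toℕ x) % m
  toℕ-shift d x = toℕ-fromℕ< _

  toℕ%m : ∀ (x : Fin m) → toℕ x % m ≡ toℕ x
  toℕ%m x = m<n⇒m%n≡m (toℕ<n x)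

  shift-shift : ∀ d e x → shift d (shift e x) ≡ shift (d + e) x
  shift-shift d e x = toℕ-injective (begin
    toℕ (shift d (shift e x))  ≡⟨ toℕ-shift d (shift e x) ⟩
    (d + toℕ (shift e x)) % m  ≡⟨ cong (λ r → (d + r) % m) (toℕ-shift e x) ⟩
    (d + (e + toℕ x) % m) % m  ≡⟨ cong (_% m) (+-comm d _) ⟩
    ((e + toℕ x) % m + d) % m  ≡⟨ [a%m+b]%m≡[a+b]%m (e + toℕ x) d m ⟩
    (e + toℕ x + d) % m        ≡⟨ cong (_% m) (trans (+-comm (e + toℕ x) d) (sym (+-assoc d e (toℕ x)))) ⟩
    (d + e + toℕ x) % m        ≡⟨ sym (toℕ-shift (d + e) x) ⟩
    toℕ (shift (d + e) x)      ∎)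
    where open ≡-Reasoning

  shift-period : ∀ k x → shift (k * m) x ≡ x
  shift-period k x = toℕ-injective (begin
    toℕ (shift (k * m) x)  ≡⟨ toℕ-shift (k * m) x ⟩
    (k * m + toℕ x) % m    ≡⟨ cong (_% m) (+-comm (k * m) (toℕ x)) ⟩
    (toℕ x + k * m) % m    ≡⟨ [m+kn]%n≡m%n (toℕ x) k m ⟩
    toℕ x % m              ≡⟨ toℕ%m x ⟩
    toℕ x                  ∎)
    where open ≡-Reasoning

  -- If i + x ≡ x (mod m) then m ∣ i, impossible for 0 < i < m.
  shift-≢ : ∀ i x → 0 < i → i < m → shift i x ≢ x
  shift-≢ i@(suc _) x _ i<m eq = >⇒∤ i<m (divides ((i + toℕ x) / m) i≡q*m)
    where
    open ≡-Reasoning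
    x+i≡x+q*m : toℕ x + i ≡ toℕ x + (i + toℕ x) / m * m
    x+i≡x+q*m = begin
      toℕ x + i                            ≡⟨ +-comm (toℕ x) i ⟩
      i + toℕ x                            ≡⟨ m≡m%n+[m/n]*n (i + toℕ x) m ⟩
      (i + toℕ x) % m + (i + toℕ x) / m * m ≡⟨ cong (_+ (i + toℕ x) / m * m)
                                                  (trans (sym (toℕ-shift i x)) (cong toℕ eq)) ⟩
      toℕ x + (i + toℕ x) / m * m          ∎
    i≡q*m : i ≡ (i + toℕ x) / m * m
    i≡q*m = +-cancelˡ-≡ (toℕ x) i _ x+i≡x+q*m

  iterate-shift : ∀ d i x → iterate (shift d) i x ≡ shift (i * d) x
  iterate-shift d zero x = sym (shift-period 0 x)
  iterate-shift d (suc i) x = trans (cong (shift d) (iterate-shift d i x)) (shift-shift d (i * d) x)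

  shift-m : ∀ x → shift m x ≡ x
  shift-m x = subst (λ d → shift d x ≡ x) (*-identityˡ m) (shift-period 1 x)

  shift-one-shift-pred : ∀ x → shift 1 (shift n x) ≡ x
  shift-one-shift-pred x = trans (shift-shift 1 n x) (shift-m x)

  shift-one-OnCycle : ∀ x → OnCycle m (shift 1) x
  shift-one-OnCycle x =
    trans (iterate-shift 1 m x) (trans (cong (λ d → shift d x) (*-identityʳ m)) (shift-m x)) ,
    λ i 0<i i<m eq → shift-≢ i x 0<i i<m
      (trans (cong (λ d → shift d x) (sym (*-identityʳ i))) (trans (sym (iterate-shift 1 i x)) eq))

  -- shift i inverts iterate (shift n) i, so a return of the latter is one of the former.
  shift-pred-OnCycle : ∀ x → OnCycle m (shift n) x
  shift-pred-OnCycle x =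
    trans (iterate-shift n m x) (trans (cong (λ d → shift d x) (*-comm m n)) (shift-period n x)) ,
    λ i 0<i i<m eq → shift-≢ i x 0<i i<m (begin
      shift i x                       ≡⟨ cong (shift i) (sym (trans (sym (iterate-shift n i x)) eq)) ⟩
      shift i (shift (i * n) x)       ≡⟨ shift-shift i (i * n) x ⟩
      shift (i + i * n) x             ≡⟨ cong (λ d → shift d x) (sym (*-suc i n)) ⟩
      shift (i * m) x                 ≡⟨ shift-period i x ⟩
      x                               ∎)
    where open ≡-Reasoning

  shift-pred≢shift-one : 2 ≤ n → ∀ x → shift n x ≢ shift 1 x
  shift-pred≢shift-one 2≤n x eq = shift-≢ 2 x (s≤s z≤n) (s≤s 2≤n) (sym (begin
    x                        ≡⟨ sym (shift-one-shift-pred x) ⟩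
    shift 1 (shift n x)      ≡⟨ cong (shift 1) eq ⟩
    shift 1 (shift 1 x)      ≡⟨ shift-shift 1 1 x ⟩
    shift 2 x                ∎))
    where open ≡-Reasoning

  diffMod-shift : ∀ d x → d < m → diffMod m x (shift d x) ≡ d
  diffMod-shift d x d<m = begin
    (toℕ (shift d x) + (m ∸ toℕ x)) % m  ≡⟨ cong (λ r → (r + (m ∸ toℕ x)) % m) (toℕ-shift d x) ⟩
    ((d + toℕ x) % m + (m ∸ toℕ x)) % m  ≡⟨ [a%m+b]%m≡[a+b]%m (d + toℕ x) (m ∸ toℕ x) m ⟩
    (d + toℕ x + (m ∸ toℕ x)) % m        ≡⟨ cong (_% m) (trans (+-assoc d (toℕ x) _) (cong (d +_) (m+[n∸m]≡n (<⇒≤ (toℕ<n x))))) ⟩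
    (d + m) % m                          ≡⟨ [m+n]%n≡m%n d m ⟩
    d % m                                ≡⟨ m<n⇒m%n≡m d<m ⟩
    d                                    ∎
    where open ≡-Reasoning

  diffMod≡⇒≡shift : ∀ d x y → diffMod m x y ≡ d → y ≡ shift d x
  diffMod≡⇒≡shift d x y eq = toℕ-injective (sym (begin
    toℕ (shift d x)                           ≡⟨ toℕ-shift d x ⟩
    (d + toℕ x) % m                           ≡⟨ cong (λ r → (r + toℕ x) % m) (sym eq) ⟩
    ((toℕ y + (m ∸ toℕ x)) % m + toℕ x) % m   ≡⟨ [a%m+b]%m≡[a+b]%m (toℕ y + (m ∸ toℕ x)) (toℕ x) m ⟩
    (toℕ y + (m ∸ toℕ x) + toℕ x) % m         ≡⟨ cong (_% m) (trans (+-assoc (toℕ y) _ _) (cong (toℕ y +_) (m∸n+n≡m (<⇒≤ (toℕ<n x))))) ⟩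
    (toℕ y + m) % m                           ≡⟨ [m+n]%n≡m%n (toℕ y) m ⟩
    toℕ y % m                                 ≡⟨ toℕ%m y ⟩
    toℕ y                                     ∎))
    where open ≡-Reasoning

  colour-proper : 0 < n → ∀ x → colour (toℕ x) ≢ colour (toℕ (shift 1 x))
  colour-proper 0<n x with m≤n⇒m<n∨m≡n (toℕ<n x)
  ... | inj₁ 1+x<m = subst (λ i → colour (toℕ x) ≢ colour i)
    (sym (trans (toℕ-shift 1 x) (m<n⇒m%n≡m 1+x<m))) (colour-suc-≢ (toℕ x))
  ... | inj₂ 1+x≡m = subst₂ (λ i j → colour i ≢ colour j)
    (sym (suc-injective 1+x≡m)) (sym (trans (toℕ-shift 1 x) (trans (cong (_% m) 1+x≡m) (n%n≡0 m))))
    (colour-≢0 0<n)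

module Factorization (n : ℕ) (2≤n : 2 ≤ n) where
  open CyclicShift n

  Vertex : Set
  Vertex = Fin m × Fin 2

  step : (Fin m → Fin 2) → Vertex → Vertex
  step s (x , a) with a ≟ s x
  ... | yes _ = shift 1 x , s (shift 1 x)
  ... | no _  = shift n x , flip (s (shift n x))

  step-forward : ∀ s x a → a ≡ s x → step s (x , a) ≡ (shift 1 x , s (shift 1 x))
  step-forward s x a a≡sx with a ≟ s x
  ... | yes _ = refl
  ... | no a≢sx = ⊥-elim (a≢sx a≡sx)

  step-backward : ∀ s x a → a ≢ s x → step s (x , a) ≡ (shift n x , flip (s (shift n x)))
  step-backward s x a a≢sx with a ≟ s x
  ... | yes a≡sx = ⊥-elim (a≢sx a≡sx)
  ... | no _ = refl

  tracks-cover : ∀ (s : Fin m → Fin 2) (P : Vertex → Set) →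
    (∀ x → P (x , s x)) → (∀ x → P (x , flip (s x))) → ∀ v → P v
  tracks-cover s P forward backward (x , a) with a ≟ s x
  ... | yes a≡sx = subst (λ b → P (x , b)) (sym a≡sx) (forward x)
  ... | no a≢sx = subst (λ b → P (x , b)) (sym (≢⇒≡flip (λ eq → a≢sx (sym eq)))) (backward x)

  successor-arc⇔ : ∀ s x a b → (s x ≡ a × s (shift 1 x) ≡ b) ⇔ (step s (x , a) ≡ (shift 1 x , b))
  successor-arc⇔ s x a b = mk⇔
    (λ (sx≡a , e) → trans (step-forward s x a (sym sx≡a)) (cong (shift 1 x ,_) e))
    (λ e → case (a ≟ s x) e)
    where
    case : Dec (a ≡ s x) → step s (x , a) ≡ (shift 1 x , b) → s x ≡ a × s (shift 1 x) ≡ b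
    case (yes a≡sx) e = sym a≡sx , cong proj₂ (trans (sym (step-forward s x a a≡sx)) e)
    case (no a≢sx) e =
      ⊥-elim (shift-pred≢shift-one 2≤n x (cong proj₁ (trans (sym (step-backward s x a a≢sx)) e)))

  predecessor-arc⇔ : ∀ s x a b →
    (s (shift n x) ≡ flip b × s x ≡ flip a) ⇔ (step s (x , a) ≡ (shift n x , b))
  predecessor-arc⇔ s x a b = mk⇔
    (λ (e , sx≡flip-a) → begin
      step s (x , a)                     ≡⟨ step-backward s x a (λ a≡sx → flip-≢ a (sym (trans a≡sx sx≡flip-a))) ⟩
      shift n x , flip (s (shift n x))   ≡⟨ cong (λ c → shift n x , flip c) e ⟩
      shift n x , flip (flip b)          ≡⟨ cong (shift n x ,_) (flip-involutive b) ⟩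
      shift n x , b                      ∎)
    (λ e → case (a ≟ s x) e)
    where
    open ≡-Reasoning
    case : Dec (a ≡ s x) → step s (x , a) ≡ (shift n x , b) → s (shift n x) ≡ flip b × s x ≡ flip a
    case (yes a≡sx) e =
      ⊥-elim (shift-pred≢shift-one 2≤n x (sym (cong proj₁ (trans (sym (step-forward s x a a≡sx)) e))))
    case (no a≢sx) e =
      trans (sym (flip-involutive _)) (cong flip (cong proj₂ (trans (sym (step-backward s x a a≢sx)) e))) ,
      ≢⇒≡flip a≢sx

  factor : (Fin m → Fin 2) → CmFactor m (H2m m)
  factor s = record
    { succ    = step s
    ; isArc   = tracks-cover s (λ v → H2m m v (step s v))
                  (λ x → subst (H2m m (x , s x)) (sym (step-forward s x _ refl))
                           (inj₁ (inj₁ (diffMod-shift 1 x (m≤n⇒m≤1+n 2≤n)))))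
                  (λ x → subst (H2m m (x , flip (s x))) (sym (step-backward s x _ (flip-≢ (s x))))
                           (inj₁ (inj₂ (diffMod-shift n x ≤-refl))))
    ; closes  = λ v → proj₁ (on-cycle v)
    ; minimal = λ v → proj₂ (on-cycle v)
    }
    where
    on-cycle : ∀ v → OnCycle m (step s) v
    on-cycle = tracks-cover s (OnCycle m (step s))
      (λ x → OnCycle-along (λ y → step-forward s y _ refl) (shift-one-OnCycle x))
      (λ x → OnCycle-along (λ y → step-backward s y _ (flip-≢ (s y))) (shift-pred-OnCycle x))

  Separating : ∀ {k} → (Fin k → Fin m → Fin 2) → Set
  Separating sel = ∀ x a b → ExactlyOne λ j → sel j x ≡ a × sel j (shift 1 x) ≡ b

  factorization : ∀ {k} (sel : Fin k → Fin m → Fin 2) → Separating sel →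
    CmFactorization m (H2m m)
  factorization {k} sel separating = record
    { k = k ; factor = λ j → factor (sel j) ; partition = arcs }
    where
    arcs : ∀ u v → H2m m u v → ExactlyOne λ j → step (sel j) u ≡ v
    arcs (x , a) (y , b) (inj₁ (inj₁ d≡1)) rewrite diffMod≡⇒≡shift 1 x y d≡1 =
      ExactlyOne-⇔ (λ j → successor-arc⇔ (sel j) x a b) (separating x a b)
    arcs (x , a) (y , b) (inj₁ (inj₂ d≡n)) rewrite diffMod≡⇒≡shift n x y d≡n =
      ExactlyOne-⇔ (λ j → predecessor-arc⇔ (sel j) x a b)
        (subst (λ z → ExactlyOne λ j → sel j (shift n x) ≡ flip b × sel j z ≡ flip a)
               (shift-one-shift-pred x) (separating (shift n x) (flip b) (flip a)))
    arcs _ _ (inj₂ (_ , ()))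

H2m-factorization : ∀ m → 3 ≤ m → CmFactorization m (H2m m)
H2m-factorization (suc n) (s≤s 2≤n) = factorization
  (λ j x → codeword j (colour (toℕ x)))
  (λ x → codeword-orthogonal _ _ (colour-proper (≤-trans (s≤s z≤n) 2≤n) x))
  where open Factorization n 2≤n
        open CyclicShift n

-- The construction does not need m to be odd.
lemma10 : (m : ℕ) → 5 ≤ m → m % 2 ≡ 1 → CmFactorization m (H2m m)
lemma10 m 5≤m _ = H2m-factorization m (≤-trans (s≤s (s≤s (s≤s z≤n))) 5≤m)
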